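{- Let $G=(V,E)$ be a simple, connected, undirected graph, $\Gamma$ its set of spanning trees, $r\neq u$ two nodes, and $\mathcal{P}$ a simple directed path in $G$ from $u$ to $r$. Then, as an identity of multisets (formal signed sums of 2-forests), $$\mathbb{F}_{r\mid u}=\sum_{\tau\in\Gamma}\left(\mathbb{F}^{\mathcal{P}}(\tau)-\mathbb{F}^{\mathcal{P}'}(\tau)\right);$$ that is, for every 2-forest $F$ of $G$, $$\left|\{\tau\in\Gamma: F\in\mathbb{F}^{\mathcal{P}}(\tau)\}\right|-\left|\{\tau\in\Gamma: F\in\mathbb{F}^{\mathcal{P}'}(\tau)\}\right|$$ equals $1$ if $F\in\mathbb{F}_{r\mid u}$ and $0$ otherwise.
   Context: A 2-forest of $G$ is a spanning forest of $G$ with exactly two trees; $\mathbb{F}_{r\mid u}$ is the set of 2-forests in which $r$ and $u$ lie in different trees. A simple directed path $\mathcal{P}$ from $u$ to $r$ is a sequence of distinct nodes $u=x_0,x_1,\dots,x_k=r$ with $\{x_i,x_{i+1}\}\in E$; its directed edges are $(x_i,x_{i+1})$. For a spanning tree $\tau$, $\mathcal{P}^{(\tau)}_{u\to r}$ denotes the unique path in $\tau$ from $u$ to $r$, with its edges directed from $u$ towards $r$. Path mapping: $\mathbb{F}^{\mathcal{P}}(\tau)=\{\tau\setminus\{i,j\}: (i,j)\text{ is a directed edge of }\mathcal{P}\text{ and }(i,j)\text{ is a directed edge of }\mathcal{P}^{(\tau)}_{u\to r}\}$ (forward path mapping) and $\mathbb{F}^{\mathcal{P}'}(\tau)=\{\tau\setminus\{i,j\}: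 (i,j)\text{ is a directed edge of }\mathcal{P}\text{ and }(j,i)\text{ is a directed edge of }\mathcal{P}^{(\tau)}_{u\to r}\}$ (reverse path mapping), where $\tau\setminus\{i,j\}$ is the 2-forest obtained by deleting edge $\{i,j\}$ from $\tau$. -}

module Defs where

open import Data.Nat using (ℕ; suc; _≤_)
open import Data.Fin using (Fin)
open import Data.Fin.Subset using (Subset; outside; _∈_; _∉_; ⊤)
open import Data.Vec using (_[_]≔_)
open import Data.Product using (_×_; _,_; Σ; ∃; ∃-syntax)
open import Data.Sum using (_⊎_)
open import Data.Maybe using (Maybe; just)
open import Data.List using (List; _∷_; []; _++_; head; last; length)
open import Data.List.Relation.Unary.Linked using (Linked)
open import Data.List.Relation.Unary.Unique.Propositional using (Unique)
import Data.List.Membership.Propositional as L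
open import Relation.Binary.PropositionalEquality using (_≡_; _≢_)
open import Relation.Binary.Construct.Closure.ReflexiveTransitive using (Star)
open import Relation.Nullary using (¬_)

-- A graph on vertex set Fin n with m edges, edge e having endpoints ends e.
-- Subgraphs (spanning) are subsets of the edge indices: Subset m.
record Graph (n m : ℕ) : Set where
  field
    ends : Fin m → Fin n × Fin n

module _ {n m : ℕ} (G : Graph n m) where
  open Graph G

  Joins : Fin m → Fin n → Fin n → Set
  Joins e x y = ends e ≡ (x , y) ⊎ ends e ≡ (y , x)

  Simple : Set
  Simple = (∀ e x → ¬ Joins e x x) × (∀ e e' x y → Joins e x y → Joins e' x y → e ≡ e')

  Adj : Subset m → Fin n → Fin n → Set
  Adj S x y = ∃[ e ] (e ∈ S × Joins e x y)

  Conn : Subset m → Fin n → Fin n → Set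
  Conn S = Star (Adj S)

  Connected : Subset m → Set
  Connected S = ∀ x y → Conn S x y

  SimplePath : Subset m → List (Fin n) → Set
  SimplePath S xs = Unique xs × Linked (Adj S) xs

  PathFromTo : Subset m → Fin n → Fin n → List (Fin n) → Set
  PathFromTo S u r xs = SimplePath S xs × head xs ≡ just u × last xs ≡ just r

  Cycle : Subset m → List (Fin n) → Set
  Cycle S xs = SimplePath S xs × 3 ≤ length xs ×
               ∃[ x ] ∃[ y ] (head xs ≡ just x × last xs ≡ just y × Adj S y x)

  Acyclic : Subset m → Set
  Acyclic S = ∀ xs → ¬ Cycle S xs

  SpanningTree : Subset m → Set
  SpanningTree S = Connected S × Acyclic S

  TwoForest : Subset m → Set
  TwoForest S = Acyclic S × ∃[ a ] ∃[ b ] (¬ Conn S a b × (∀ x → Conn S x a ⊎ Conn S x b))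

  InFru : Fin n → Fin n → Subset m → Set
  InFru r u F = TwoForest F × ¬ Conn F r u

DirEdge : {n : ℕ} → List (Fin n) → Fin n → Fin n → Set
DirEdge xs i j = ∃[ as ] ∃[ bs ] (xs ≡ as ++ (i ∷ j ∷ bs))

module _ {n m : ℕ} (G : Graph n m) where

  TreePathEdge : Subset m → Fin n → Fin n → Fin n → Fin n → Set
  TreePathEdge τ u r i j = ∃[ ys ] (PathFromTo G τ u r ys × DirEdge ys i j)

  InFwd : List (Fin n) → Fin n → Fin n → Subset m → Subset m → Set
  InFwd P u r τ F = ∃[ i ] ∃[ j ] ∃[ e ]
    (DirEdge P i j × TreePathEdge τ u r i j × e ∈ τ × Joins G e i j × F ≡ τ [ e ]≔ outside)

  InRev : List (Fin n) → Fin n → Fin n → Subset m → Subset m → Set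
  InRev P u r τ F = ∃[ i ] ∃[ j ] ∃[ e ]
    (DirEdge P i j × TreePathEdge τ u r j i × e ∈ τ × Joins G e i j × F ≡ τ [ e ]≔ outside)

Enumerates : {A : Set} → (A → Set) → List A → Set
Enumerates P xs = Unique xs × (∀ a → (a L.∈ xs → P a) × (P a → a L.∈ xs))

-- Suppose first that r and u lie in different trees of the 2-forest F, and colour every vertex by
-- the tree of F containing it (u-side or r-side). For a spanning tree τ, F = τ ∖ {i,j} with (i,j)
-- or (j,i) on the tree path from u to r forces τ = F + {i,j} where {i,j} joins the two sides: i is
-- on the u-side and j on the r-side for the forward mapping, the other way round for the reverse
-- one. Conversely, adding to F any edge of G between the two sides yields a spanning tree whose
-- u–r path uses that edge in the direction from the u-side to the r-side. So the two counts are the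
-- numbers of steps of 𝒫 going from the u-side to the r-side and back, and since 𝒫 starts on the
-- u-side and ends on the r-side these differ by exactly one. If r and u lie in the same tree of F,
-- no tree path edge removal can produce F, since removing it separates u from r; both counts vanish.

module Submission where

open import Defs
open import Data.Nat using (ℕ; suc; _+_; _∸_; s≤s; z≤n)
open import Data.Nat.Properties using (+-comm; +-identityʳ; n≤1+n; m+n∸n≡m)
open import Data.Integer using (+_; _-_; _⊖_)
open import Data.Integer.Properties using (m-n≡m⊖n; ⊖-≥)
open import Data.Bool using (false; true)
open import Data.Fin using (Fin; _≟_)
open import Data.Fin.Subset using (Subset; ⊤; inside; outside; _∈_; _∉_; _⊆_)
open import Data.Vec using (lookup; _[_]≔_)
open import Data.Vec.Properties
  using (lookup∘update; lookup∘update′; []=⇒lookup; lookup⇒[]=; []≔-idempotent; []≔-lookup;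
         []≔-updates; []≔-minimal; []≔-commutes)
open import Data.Product using (_×_; _,_; ∃-syntax; proj₁; proj₂; map₁)
open import Data.Sum using (_⊎_; inj₁; inj₂; swap)
open import Data.Maybe using (just)
import Data.Maybe.Relation.Binary.Connected as Maybe
open import Data.List using (List; _∷_; []; _++_; [_]; head; last; length)
open import Data.List.Properties using (++-assoc; ∷-injectiveʳ)
open import Data.List.Relation.Unary.Linked as Linked using (Linked; []; [-]; _∷_)
open import Data.List.Relation.Unary.Linked.Properties using (Linked⇒All) renaming (++⁺ to Linked-++⁺)
open import Data.List.Relation.Unary.All as All using (All; []; _∷_)
open import Data.List.Relation.Unary.All.Properties using (¬Any⇒All¬; All¬⇒¬Any)
open import Data.List.Relation.Unary.AllPairs using ([]; _∷_)
open import Data.List.Relation.Unary.Any using (here; there)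
open import Data.List.Relation.Unary.Unique.Propositional using (Unique)
open import Data.List.Relation.Unary.Unique.Propositional.Properties using () renaming (++⁺ to Unique-++⁺)
open import Data.List.Membership.Propositional using () renaming (_∈_ to _∈ₗ_; _∉_ to _∉ₗ_)
open import Data.List.Membership.Propositional.Properties using (∈-++⁺ʳ)
open import Data.List.Membership.Propositional.Properties.WithK using (unique∧set⇒bag)
import Data.List.Membership.DecPropositional as DecMembership
open import Data.List.Relation.Binary.BagAndSetEquality using (∼bag⇒↭)
open import Data.List.Relation.Binary.Permutation.Propositional.Properties using (↭-length)
open import Function using (_∘_)
open import Function.Bundles using (mk⇔)
open import Relation.Binary.PropositionalEquality
  using (_≡_; _≢_; refl; sym; trans; cong; cong₂; subst; module ≡-Reasoning)
open import Relation.Binary.Construct.Closure.ReflexiveTransitive using (ε; _◅_; _◅◅_)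
  renaming (reverse to Star-reverse; map to Star-map)
open import Relation.Nullary using (¬_; yes; no)
open import Data.Empty using (⊥-elim)

module _ {m : ℕ} where

  _─_ : Subset m → Fin m → Subset m
  S ─ e = S [ e ]≔ outside

  _＋_ : Subset m → Fin m → Subset m
  S ＋ e = S [ e ]≔ inside

  ∈-[]≔⁻ : ∀ {S : Subset m} {e f} b → f ≢ e → f ∈ S [ e ]≔ b → f ∈ S
  ∈-[]≔⁻ {S} b f≢e f∈ = lookup⇒[]= _ S (trans (sym (lookup∘update′ f≢e S b)) ([]=⇒lookup f∈))

  ∉-─-self : ∀ (S : Subset m) e → e ∉ S ─ e
  ∉-─-self S e e∈ with trans (sym (lookup∘update e S outside)) ([]=⇒lookup e∈)
  ... | ()

  ─-⊆ : ∀ {S : Subset m} {e} → S ─ e ⊆ S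
  ─-⊆ {S} {e} {f} f∈ with f ≟ e
  ... | yes refl = ⊥-elim (∉-─-self S e f∈)
  ... | no f≢e = ∈-[]≔⁻ outside f≢e f∈

  ⊆-＋ : ∀ {S : Subset m} {e} → S ⊆ S ＋ e
  ⊆-＋ {S} {e} {f} f∈ with f ≟ e
  ... | yes refl = []≔-updates S e
  ... | no f≢e = []≔-minimal S f e f≢e f∈

  []≔-restore : ∀ (S : Subset m) e {b c} → lookup S e ≡ b → (S [ e ]≔ c) [ e ]≔ b ≡ S
  []≔-restore S e {b} S[e]≡b = begin
    (S [ e ]≔ _) [ e ]≔ b   ≡⟨ []≔-idempotent S e ⟩
    S [ e ]≔ b              ≡⟨ cong (S [ e ]≔_) S[e]≡b ⟨
    S [ e ]≔ lookup S e     ≡⟨ []≔-lookup S e ⟩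
    S                       ∎
    where open ≡-Reasoning

  ─-＋-cancel : ∀ {S : Subset m} {e} → e ∈ S → (S ─ e) ＋ e ≡ S
  ─-＋-cancel {S} {e} e∈S = []≔-restore S e ([]=⇒lookup e∈S)

  ＋-─-cancel : ∀ {S : Subset m} {e} → e ∉ S → (S ＋ e) ─ e ≡ S
  ＋-─-cancel {S} {e} e∉S = []≔-restore S e S[e]≡outside
    where
    S[e]≡outside : lookup S e ≡ outside
    S[e]≡outside with lookup S e in eq
    ... | false = refl
    ... | true = ⊥-elim (e∉S (lookup⇒[]= e S eq))

  ＋-injective : ∀ {S : Subset m} {e f} → f ∉ S → S ＋ e ≡ S ＋ f → e ≡ f
  ＋-injective {S} {e} {f} f∉S eq with e ≟ f
  ... | yes e≡f = e≡f
  ... | no e≢f = ⊥-elim (f∉S (∈-[]≔⁻ inside (e≢f ∘ sym) (subst (f ∈_) (sym eq) ([]≔-updates S f))))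

module _ {A : Set} where

  head-++-∷ : ∀ (xs : List A) {y ys zs} → head (xs ++ y ∷ ys) ≡ head (xs ++ y ∷ zs)
  head-++-∷ [] = refl
  head-++-∷ (x ∷ xs) = refl

  last-++-∷ : ∀ (xs : List A) {y ys} → last (xs ++ y ∷ ys) ≡ last (y ∷ ys)
  last-++-∷ [] = refl
  last-++-∷ (x ∷ []) = refl
  last-++-∷ (x ∷ x′ ∷ xs) = last-++-∷ (x′ ∷ xs)

  last⇒∈ : ∀ {x y : A} xs → last (x ∷ xs) ≡ just y → y ∈ₗ x ∷ xs
  last⇒∈ [] refl = here refl
  last⇒∈ (x′ ∷ xs) last≡y = there (last⇒∈ xs last≡y)

  last⇒∷ʳ : ∀ (xs : List A) {y} → last xs ≡ just y → ∃[ ys ] xs ≡ ys ++ [ y ]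
  last⇒∷ʳ (x ∷ []) refl = [] , refl
  last⇒∷ʳ (x ∷ x′ ∷ xs) last≡y with last⇒∷ʳ (x′ ∷ xs) last≡y
  ... | ys , eq = x ∷ ys , cong (x ∷_) eq

  Unique-++-∉ : ∀ (xs : List A) {y ys} → Unique (xs ++ y ∷ ys) → y ∉ₗ xs × y ∉ₗ ys
  Unique-++-∉ [] (y∉ys ∷ _) = (λ ()) , All¬⇒¬Any y∉ys
  Unique-++-∉ (x ∷ xs) {y} (x∉ ∷ u) with Unique-++-∉ xs u
  ... | y∉xs , y∉ys = y∉x∷xs , y∉ys
    where
    y∉x∷xs : y ∉ₗ x ∷ xs
    y∉x∷xs (here refl) = All.lookup x∉ (∈-++⁺ʳ xs (here refl)) refl
    y∉x∷xs (there y∈xs) = y∉xs y∈xs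

  Linked-++⁻ : ∀ {R : A → A → Set} (xs : List A) {ys} → Linked R (xs ++ ys) → Linked R xs × Linked R ys
  Linked-++⁻ [] l = [] , l
  Linked-++⁻ (x ∷ []) {[]} l = [-] , []
  Linked-++⁻ (x ∷ []) {y ∷ ys} (_ ∷ l) = [-] , l
  Linked-++⁻ (x ∷ x′ ∷ xs) (r ∷ l) = map₁ (r ∷_) (Linked-++⁻ (x′ ∷ xs) l)

  Enumerates-length : ∀ {Q : A → Set} {xs ys} → Enumerates Q xs → Unique ys →
                      (∀ {a} → Q a → a ∈ₗ ys) → (∀ {a} → a ∈ₗ ys → Q a) → length xs ≡ length ys
  Enumerates-length (xs-unique , enum) ys-unique Q⇒∈ ∈⇒Q =
    ↭-length (∼bag⇒↭ (unique∧set⇒bag xs-unique ys-unique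
      (mk⇔ (Q⇒∈ ∘ proj₁ (enum _)) (proj₂ (enum _) ∘ ∈⇒Q))))

  Enumerates-empty : ∀ {Q : A → Set} {xs} → Enumerates Q xs → (∀ a → ¬ Q a) → length xs ≡ 0
  Enumerates-empty {xs = []} _ _ = refl
  Enumerates-empty {xs = x ∷ _} (_ , enum) ¬Q = ⊥-elim (¬Q x (proj₁ (enum x) (here refl)))

rank : ∀ {A B : Set} → A ⊎ B → ℕ
rank (inj₁ _) = 0
rank (inj₂ _) = 1

module _ {n : ℕ} where

  DirEdge⇒∈ : ∀ {xs} {a b : Fin n} → DirEdge xs a b → a ∈ₗ xs × b ∈ₗ xs
  DirEdge⇒∈ (as , _ , refl) = ∈-++⁺ʳ as (here refl) , ∈-++⁺ʳ as (there (here refl))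

  DirEdge-∷⁻ : ∀ {x y xs} {a b : Fin n} → DirEdge (x ∷ y ∷ xs) a b → (a ≡ x × b ≡ y) ⊎ DirEdge (y ∷ xs) a b
  DirEdge-∷⁻ ([] , _ , refl) = inj₁ (refl , refl)
  DirEdge-∷⁻ (_ ∷ as , bs , eq) = inj₂ (as , bs , ∷-injectiveʳ eq)

  DirEdge-∷⁺ : ∀ {x xs} {a b : Fin n} → DirEdge xs a b → DirEdge (x ∷ xs) a b
  DirEdge-∷⁺ {x} (as , bs , eq) = x ∷ as , bs , cong (x ∷_) eq

module Walks {n m : ℕ} (G : Graph n m) where
  open DecMembership (_≟_ {n}) using (_∈?_)

  Joins-sym : ∀ {e x y} → Joins G e x y → Joins G e y x
  Joins-sym = swap

  Joins-ends : ∀ {e a b c d} → Joins G e a b → Joins G e c d → (a ≡ c × b ≡ d) ⊎ (a ≡ d × b ≡ c)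
  Joins-ends (inj₁ refl) (inj₁ refl) = inj₁ (refl , refl)
  Joins-ends (inj₁ refl) (inj₂ refl) = inj₂ (refl , refl)
  Joins-ends (inj₂ refl) (inj₁ refl) = inj₂ (refl , refl)
  Joins-ends (inj₂ refl) (inj₂ refl) = inj₁ (refl , refl)

  Joins⇒∉ : ∀ {S e a b} → ¬ Conn G S a b → Joins G e a b → e ∉ S
  Joins⇒∉ a≁b eab e∈S = a≁b ((_ , e∈S , eab) ◅ ε)

  Adj-mono : ∀ {S S′} → S ⊆ S′ → ∀ {x y} → Adj G S x y → Adj G S′ x y
  Adj-mono S⊆S′ (e , e∈S , exy) = e , S⊆S′ e∈S , exy

  Conn-sym : ∀ {S x y} → Conn G S x y → Conn G S y x
  Conn-sym = Star-reverse (λ (e , e∈S , exy) → e , e∈S , Joins-sym exy)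

  Conn-mono : ∀ {S S′} → S ⊆ S′ → ∀ {x y} → Conn G S x y → Conn G S′ x y
  Conn-mono S⊆S′ = Star-map (Adj-mono S⊆S′)

  Linked-mono : ∀ {S S′} → S ⊆ S′ → ∀ {xs} → Linked (Adj G S) xs → Linked (Adj G S′) xs
  Linked-mono S⊆S′ = Linked.map (Adj-mono S⊆S′)

  Linked⇒Conn-head : ∀ {S x xs} → Linked (Adj G S) (x ∷ xs) → All (Conn G S x) (x ∷ xs)
  Linked⇒Conn-head = Linked⇒All _◅◅_ ε ∘ Linked.map (_◅ ε)

  Linked⇒Conn : ∀ {S x y xs} → Linked (Adj G S) xs → head xs ≡ just x → last xs ≡ just y → Conn G S x y
  Linked⇒Conn {xs = x ∷ xs} l refl last≡y = All.lookup (Linked⇒Conn-head l) (last⇒∈ xs last≡y)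

  Adj-─ : ∀ {S e v w a b} → v ≢ a → v ≢ b → Joins G e v w → Adj G S a b → Adj G (S ─ e) a b
  Adj-─ {S} {e} v≢a v≢b evw (f , f∈S , fab) with f ≟ e
  ... | no f≢e = f , []≔-minimal S f e f≢e f∈S , fab
  ... | yes refl with Joins-ends fab evw
  ...   | inj₁ (a≡v , _) = ⊥-elim (v≢a (sym a≡v))
  ...   | inj₂ (_ , b≡v) = ⊥-elim (v≢b (sym b≡v))

  Linked-─ : ∀ {S e v w zs} → v ∉ₗ zs → Joins G e v w → Linked (Adj G S) zs → Linked (Adj G (S ─ e)) zs
  Linked-─ v∉ evw [] = []
  Linked-─ v∉ evw [-] = [-]
  Linked-─ v∉ evw (a ∷ l) = Adj-─ (v∉ ∘ here) (v∉ ∘ there ∘ here) evw a ∷ Linked-─ (v∉ ∘ there) evw l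

  SimplePath-suffix : ∀ {S x y ys} → x ∈ₗ ys → SimplePath G S ys → last ys ≡ just y →
                      ∃[ ws ] PathFromTo G S x y (x ∷ ws)
  SimplePath-suffix {ys = _ ∷ ws} (here refl) path last≡y = ws , path , refl , last≡y
  SimplePath-suffix {ys = _ ∷ _ ∷ _} (there x∈) (_ ∷ u , _ ∷ l) last≡y = SimplePath-suffix x∈ (u , l) last≡y

  -- A walk becomes a simple path by cutting out every closed subwalk.
  Conn⇒Path : ∀ {S x y} → Conn G S x y → ∃[ ws ] PathFromTo G S x y (x ∷ ws)
  Conn⇒Path ε = [] , (([] ∷ []) , [-]) , refl , refl
  Conn⇒Path {x = x} (_◅_ {j = z} x~z z~y) with Conn⇒Path z~y
  ... | zs , (u , l) , _ , last≡y with x ∈? z ∷ zs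
  ...   | yes x∈ = SimplePath-suffix x∈ (u , l) last≡y
  ...   | no x∉ = z ∷ zs , ((¬Any⇒All¬ _ x∉ ∷ u) , x~z ∷ l) , refl , last≡y

module Forests {n m : ℕ} (G : Graph n m) (simple : Simple G) where
  open Walks G

  private
    noLoop : ∀ e x → ¬ Joins G e x x
    noLoop = proj₁ simple

    noParallel : ∀ e f x y → Joins G e x y → Joins G f x y → e ≡ f
    noParallel = proj₂ simple

  Acyclic⇒bridge : ∀ {S e a b} → Acyclic G S → e ∈ S → Joins G e a b → ¬ Conn G (S ─ e) a b
  Acyclic⇒bridge {S} {e} {a} {b} acyclic e∈S eab a~b with Conn⇒Path a~b
  ... | [] , _ , _ , refl = noLoop e a eab
  ... | _ ∷ [] , (_ , (f , f∈ , fab) ∷ [-]) , _ , refl with noParallel f e a b fab eab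
  ...   | refl = ∉-─-self S e f∈
  Acyclic⇒bridge {S} {e} {a} {b} acyclic e∈S eab a~b | c ∷ d ∷ ws , (u , l) , _ , last≡b =
    acyclic (a ∷ c ∷ d ∷ ws)
      ((u , Linked-mono ─-⊆ l) , s≤s (s≤s (s≤s z≤n)) , a , b , refl , last≡b , e , e∈S , Joins-sym eab)

  cycle⇒nonBridge : ∀ {S xs} → Cycle G S xs →
                    ∃[ e ] ∃[ x ] ∃[ y ] (e ∈ S × Joins G e x y × Conn G (S ─ e) x y)
  cycle⇒nonBridge {xs = _ ∷ []} (_ , s≤s () , _)
  cycle⇒nonBridge {xs = _ ∷ _ ∷ []} (_ , s≤s (s≤s ()) , _)
  cycle⇒nonBridge {S} {x ∷ y ∷ z ∷ zs}
    (((x∉ ∷ y∉ ∷ _) , (e , e∈S , exy) ∷ l) , _ , _ , w , refl , last≡w , (f , f∈S , fwx)) =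
    e , x , y , e∈S , exy , Conn-sym (y~w ◅◅ (f , []≔-minimal S f e f≢e f∈S , fwx) ◅ ε)
    where
    y~w : Conn G (S ─ e) y w
    y~w = Linked⇒Conn (Linked-─ (All¬⇒¬Any x∉) exy l) refl last≡w
    w∈ : w ∈ₗ z ∷ zs
    w∈ = last⇒∈ zs last≡w
    f≢e : f ≢ e
    f≢e refl with Joins-ends fwx exy
    ... | inj₁ (w≡x , _) = All.lookup x∉ (there w∈) (sym w≡x)
    ... | inj₂ (w≡y , _) = All.lookup y∉ w∈ (sym w≡y)

  ConnVia : Subset m → Fin n → Fin n → Fin n → Fin n → Set
  ConnVia S i j x y = Conn G S x y ⊎ (Conn G S x i × Conn G S j y) ⊎ (Conn G S x j × Conn G S i y)

  ConnVia-◅ : ∀ {S i j x z y} → Adj G S x z → ConnVia S i j z y → ConnVia S i j x y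
  ConnVia-◅ x~z (inj₁ z~y) = inj₁ (x~z ◅ z~y)
  ConnVia-◅ x~z (inj₂ (inj₁ (z~i , j~y))) = inj₂ (inj₁ (x~z ◅ z~i , j~y))
  ConnVia-◅ x~z (inj₂ (inj₂ (z~j , i~y))) = inj₂ (inj₂ (x~z ◅ z~j , i~y))

  ConnVia-swap : ∀ {S i j x y} → ConnVia S i j x y → ConnVia S j i x y
  ConnVia-swap (inj₁ x~y) = inj₁ x~y
  ConnVia-swap (inj₂ via) = inj₂ (swap via)

  ConnVia-cross : ∀ {S i j y} → ConnVia S i j j y → ConnVia S i j i y
  ConnVia-cross (inj₁ j~y) = inj₂ (inj₁ (ε , j~y))
  ConnVia-cross (inj₂ (inj₁ (_ , j~y))) = inj₂ (inj₁ (ε , j~y))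
  ConnVia-cross (inj₂ (inj₂ (_ , i~y))) = inj₁ i~y

  Conn-＋⁻ : ∀ {S e i j x y} → Joins G e i j → Conn G (S ＋ e) x y → ConnVia S i j x y
  Conn-＋⁻ eij ε = inj₁ ε
  Conn-＋⁻ {S} {e} eij ((f , f∈ , fxz) ◅ z~y) with f ≟ e
  ... | no f≢e = ConnVia-◅ (f , ∈-[]≔⁻ inside f≢e f∈ , fxz) (Conn-＋⁻ eij z~y)
  ... | yes refl with Joins-ends fxz eij
  ...   | inj₁ (refl , refl) = ConnVia-cross (Conn-＋⁻ eij z~y)
  ...   | inj₂ (refl , refl) = ConnVia-swap (ConnVia-cross (ConnVia-swap (Conn-＋⁻ eij z~y)))

  Acyclic-＋ : ∀ {F e i j} → Acyclic G F → Joins G e i j → ¬ Conn G F i j → Acyclic G (F ＋ e)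
  Acyclic-＋ {F} {e} {i} {j} acyclic eij i≁j xs cycle with cycle⇒nonBridge cycle
  ... | f , x , y , f∈ , fxy , x~y with f ≟ e
  ...   | yes refl = i≁j (endpoints (Joins-ends fxy eij))
    where
    x~y′ : Conn G F x y
    x~y′ = Conn-mono ─-⊆ (subst (λ S → Conn G S x y) ([]≔-idempotent F e) x~y)
    endpoints : (x ≡ i × y ≡ j) ⊎ (x ≡ j × y ≡ i) → Conn G F i j
    endpoints (inj₁ (refl , refl)) = x~y′
    endpoints (inj₂ (refl , refl)) = Conn-sym x~y′
  ...   | no f≢e
    with ∈-[]≔⁻ inside f≢e f∈ | Conn-＋⁻ eij (subst (λ S → Conn G S x y) ([]≔-commutes F e f (f≢e ∘ sym)) x~y)
  ...     | f∈F | inj₁ x~y′ = Acyclic⇒bridge acyclic f∈F fxy x~y′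
  ...     | f∈F | inj₂ (inj₁ (x~i , j~y)) =
    i≁j (Conn-sym (Conn-mono ─-⊆ x~i) ◅◅ (f , f∈F , fxy) ◅ Conn-sym (Conn-mono ─-⊆ j~y))
  ...     | f∈F | inj₂ (inj₂ (x~j , i~y)) =
    i≁j (Conn-mono ─-⊆ i~y ◅◅ (f , f∈F , Joins-sym fxy) ◅ Conn-mono ─-⊆ x~j)

  Sides : Subset m → Fin n → Fin n → Set
  Sides F p q = ∀ v → Conn G F v p ⊎ Conn G F v q

  twoForest-sides : ∀ {F p q} → TwoForest G F → ¬ Conn G F p q → Sides F p q
  twoForest-sides {p = p} {q} (_ , a , b , _ , a-or-b) p≁q v with a-or-b p | a-or-b q | a-or-b v
  ... | inj₁ p~a | inj₁ q~a | _ = ⊥-elim (p≁q (p~a ◅◅ Conn-sym q~a))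
  ... | inj₂ p~b | inj₂ q~b | _ = ⊥-elim (p≁q (p~b ◅◅ Conn-sym q~b))
  ... | inj₁ p~a | inj₂ q~b | inj₁ v~a = inj₁ (v~a ◅◅ Conn-sym p~a)
  ... | inj₁ p~a | inj₂ q~b | inj₂ v~b = inj₂ (v~b ◅◅ Conn-sym q~b)
  ... | inj₂ p~b | inj₁ q~a | inj₁ v~a = inj₂ (v~a ◅◅ Conn-sym q~a)
  ... | inj₂ p~b | inj₁ q~a | inj₂ v~b = inj₁ (v~b ◅◅ Conn-sym p~b)

  Connected-＋ : ∀ {F e a b p q} → Sides F p q → Conn G F a p → Conn G F b q → Joins G e a b → Connected G (F ＋ e)
  Connected-＋ {F} {e} {a} {b} {p} {q} side a~p b~q eab x y = toP x ◅◅ Conn-sym (toP y)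
    where
    toP : ∀ v → Conn G (F ＋ e) v p
    toP v with side v
    ... | inj₁ v~p = Conn-mono ⊆-＋ v~p
    ... | inj₂ v~q =
      Conn-mono ⊆-＋ (v~q ◅◅ Conn-sym b~q) ◅◅ (e , []≔-updates F e , Joins-sym eab) ◅ Conn-mono ⊆-＋ a~p

  treePath-sides : ∀ {τ u r a b e} → TreePathEdge G τ u r a b → Joins G e a b →
                   Conn G (τ ─ e) u a × Conn G (τ ─ e) b r
  treePath-sides {τ} {a = a} {b} (_ , ((ys-unique , ys-linked) , head≡u , last≡r) , as , bs , refl) eab =
    Linked⇒Conn (Linked-─ b∉pre (Joins-sym eab) pre-linked) (trans (head-++-∷ as) head≡u) (last-++-∷ as) ,
    Linked⇒Conn (Linked-─ a∉post eab post-linked) refl (trans (sym (last-++-∷ as)) last≡r)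
    where
    split : as ++ a ∷ b ∷ bs ≡ (as ++ [ a ]) ++ b ∷ bs
    split = sym (++-assoc as [ a ] (b ∷ bs))
    pre-linked : Linked (Adj G τ) (as ++ [ a ])
    pre-linked = proj₁ (Linked-++⁻ (as ++ [ a ]) (subst (Linked _) split ys-linked))
    post-linked : Linked (Adj G τ) (b ∷ bs)
    post-linked = proj₂ (Linked-++⁻ (as ++ [ a ]) (subst (Linked _) split ys-linked))
    b∉pre : b ∉ₗ as ++ [ a ]
    b∉pre = proj₁ (Unique-++-∉ (as ++ [ a ]) (subst Unique split ys-unique))
    a∉post : a ∉ₗ b ∷ bs
    a∉post = proj₂ (Unique-++-∉ as ys-unique)

  treePath-＋ : ∀ {F u r a b e} → Conn G F a u → Conn G F b r → Joins G e a b → ¬ Conn G F u r →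
                TreePathEdge G (F ＋ e) u r a b
  treePath-＋ {F} {u} {r} {a} {b} {e} a~u b~r eab u≁r with Conn⇒Path (Conn-sym a~u) | Conn⇒Path b~r
  ... | ps , ((ps-unique , ps-linked) , _ , last≡a) | qs , ((qs-unique , qs-linked) , _ , last≡r)
    with last⇒∷ʳ (u ∷ ps) last≡a
  ... | as , u∷ps≡as∷ʳa =
    (u ∷ ps) ++ b ∷ qs , ((unique , linked) , refl , trans (last-++-∷ (u ∷ ps)) last≡r) , as , qs , split
    where
    unique : Unique ((u ∷ ps) ++ b ∷ qs)
    unique = Unique-++⁺ ps-unique qs-unique λ (v∈ps , v∈qs) →
      u≁r (All.lookup (Linked⇒Conn-head ps-linked) v∈ps ◅◅
           Conn-sym (All.lookup (Linked⇒Conn-head qs-linked) v∈qs) ◅◅ b~r)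
    linked : Linked (Adj G (F ＋ e)) ((u ∷ ps) ++ b ∷ qs)
    linked = Linked-++⁺ (Linked-mono ⊆-＋ ps-linked)
                        (subst (λ end → Maybe.Connected _ end (just b)) (sym last≡a)
                               (Maybe.just (e , []≔-updates F e , eab)))
                        (Linked-mono ⊆-＋ qs-linked)
    split : (u ∷ ps) ++ b ∷ qs ≡ as ++ a ∷ b ∷ qs
    split = trans (cong (_++ b ∷ qs) u∷ps≡as∷ʳa) (++-assoc as [ a ] (b ∷ qs))

  crossings : ∀ {F p q} → Sides F p q → ∀ xs → Linked (Adj G ⊤) xs → List (Subset m)
  crossings side [] _ = []
  crossings side (x ∷ []) _ = []
  crossings {F} side (x ∷ y ∷ xs) ((e , _) ∷ l) with side x | side y
  ... | inj₁ _ | inj₂ _ = F ＋ e ∷ crossings side (y ∷ xs) l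
  ... | _ | _ = crossings side (y ∷ xs) l

  Crossing : Subset m → Fin n → Fin n → List (Fin n) → Subset m → Set
  Crossing F p q xs τ =
    ∃[ e ] ∃[ a ] ∃[ b ] (DirEdge xs a b × Joins G e a b × Conn G F a p × Conn G F b q × τ ≡ F ＋ e)

  crossings-∷ : ∀ {F p q} (side : Sides F p q) {x y xs τ} (a : Adj G ⊤ x y) (l : Linked (Adj G ⊤) (y ∷ xs)) →
                τ ∈ₗ crossings side (y ∷ xs) l → τ ∈ₗ crossings side (x ∷ y ∷ xs) (a ∷ l)
  crossings-∷ side {x} {y} _ _ τ∈ with side x | side y
  ... | inj₁ _ | inj₂ _ = there τ∈
  ... | inj₁ _ | inj₁ _ = τ∈
  ... | inj₂ _ | _ = τ∈

  Crossing-∷ : ∀ {F p q x xs τ} → Crossing F p q xs τ → Crossing F p q (x ∷ xs) τ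
  Crossing-∷ (e , a , b , dir , rest) = e , a , b , DirEdge-∷⁺ dir , rest

  ∈-crossings⁻ : ∀ {F p q} (side : Sides F p q) {xs τ} (l : Linked (Adj G ⊤) xs) →
                 τ ∈ₗ crossings side xs l → Crossing F p q xs τ
  ∈-crossings⁻ side {x ∷ y ∷ xs} ((e , _ , exy) ∷ l) τ∈ with side x | side y | τ∈
  ... | inj₁ x~p | inj₂ y~q | here refl = e , x , y , ([] , xs , refl) , exy , x~p , y~q , refl
  ... | inj₁ _ | inj₂ _ | there τ∈′ = Crossing-∷ (∈-crossings⁻ side l τ∈′)
  ... | inj₁ _ | inj₁ _ | τ∈′ = Crossing-∷ (∈-crossings⁻ side l τ∈′)
  ... | inj₂ _ | _ | τ∈′ = Crossing-∷ (∈-crossings⁻ side l τ∈′)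

  ∈-crossings⁺ : ∀ {F p q} (side : Sides F p q) → ¬ Conn G F p q → ∀ {xs τ} (l : Linked (Adj G ⊤) xs) →
                 Crossing F p q xs τ → τ ∈ₗ crossings side xs l
  ∈-crossings⁺ side p≁q [] (_ , _ , _ , ([] , _ , ()) , _)
  ∈-crossings⁺ side p≁q [] (_ , _ , _ , (_ ∷ _ , _ , ()) , _)
  ∈-crossings⁺ side p≁q [-] (_ , _ , _ , ([] , _ , ()) , _)
  ∈-crossings⁺ side p≁q [-] (_ , _ , _ , (_ ∷ [] , _ , ()) , _)
  ∈-crossings⁺ side p≁q [-] (_ , _ , _ , (_ ∷ _ ∷ _ , _ , ()) , _)
  ∈-crossings⁺ side p≁q (adj@(f , _ , fxy) ∷ l) (e , a , b , dir , eab , a~p , b~q , refl) with DirEdge-∷⁻ dir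
  ... | inj₂ dir′ = crossings-∷ side adj l (∈-crossings⁺ side p≁q l (e , a , b , dir′ , eab , a~p , b~q , refl))
  ... | inj₁ (refl , refl) with side a | side b
  ...   | inj₁ _ | inj₂ _ = here (cong (_ ＋_) (noParallel e f a b eab fxy))
  ...   | inj₂ a~q | _ = ⊥-elim (p≁q (Conn-sym a~p ◅◅ a~q))
  ...   | inj₁ _ | inj₁ b~p = ⊥-elim (p≁q (Conn-sym b~p ◅◅ b~q))

  crossings-unique : ∀ {F p q} (side : Sides F p q) → ¬ Conn G F p q → ∀ {xs} (l : Linked (Adj G ⊤) xs) →
                     Unique xs → Unique (crossings side xs l)
  crossings-unique side p≁q [] _ = []
  crossings-unique side p≁q [-] _ = []
  crossings-unique {F} side p≁q {x ∷ y ∷ xs} ((e , _ , exy) ∷ l) (x∉ ∷ u) with side x | side y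
  ... | inj₁ _ | inj₂ _ = All.tabulate fresh ∷ crossings-unique side p≁q l u
    where
    -- Distinct crossing edges give distinct trees, and e has an endpoint x outside the rest of the path.
    fresh : ∀ {τ} → τ ∈ₗ crossings side (y ∷ xs) l → F ＋ e ≢ τ
    fresh τ∈ F＋e≡τ with ∈-crossings⁻ side l τ∈
    ... | f , a , b , dir , fab , a~p , b~q , refl
        with ＋-injective (Joins⇒∉ (λ a~b → p≁q (Conn-sym a~p ◅◅ a~b ◅◅ b~q)) fab) F＋e≡τ
    ...   | refl with Joins-ends exy fab
    ...     | inj₁ (x≡a , _) = All.lookup x∉ (proj₁ (DirEdge⇒∈ dir)) x≡a
    ...     | inj₂ (x≡b , _) = All.lookup x∉ (proj₂ (DirEdge⇒∈ dir)) x≡b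
  ... | inj₁ _ | inj₁ _ = crossings-unique side p≁q l u
  ... | inj₂ _ | _ = crossings-unique side p≁q l u

  -- Telescoping: each step of the walk that changes side is a crossing in exactly one direction.
  crossings-count : ∀ {F p q} (side : Sides F p q) {x xs y} (l : Linked (Adj G ⊤) (x ∷ xs)) →
                    last (x ∷ xs) ≡ just y →
                    length (crossings side (x ∷ xs) l) + rank (side x) ≡
                    length (crossings (swap ∘ side) (x ∷ xs) l) + rank (side y)
  crossings-count side [-] refl = refl
  crossings-count side {x} {x′ ∷ xs} (_ ∷ l) last≡y with side x | side x′ | crossings-count side l last≡y
  ... | inj₁ _ | inj₁ _ | count = count
  ... | inj₂ _ | inj₂ _ | count = count
  ... | inj₁ _ | inj₂ _ | count = trans (cong suc (+-identityʳ _)) (trans (+-comm 1 _) count)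
  ... | inj₂ _ | inj₁ _ | count = trans (+-comm _ 1) (cong suc (trans (sym (+-identityʳ _)) count))

  crossings-path-count : ∀ {F p q} (side : Sides F p q) → ¬ Conn G F p q → ∀ {xs} (l : Linked (Adj G ⊤) xs) →
                         head xs ≡ just p → last xs ≡ just q →
                         length (crossings side xs l) ≡ suc (length (crossings (swap ∘ side) xs l))
  crossings-path-count {p = p} {q} side p≁q {p ∷ xs} l refl last≡q with side p | side q | crossings-count side l last≡q
  ... | inj₁ _ | inj₂ _ | count = trans (sym (+-identityʳ _)) (trans count (+-comm _ 1))
  ... | inj₂ p~q | _ | _ = ⊥-elim (p≁q p~q)
  ... | inj₁ _ | inj₁ q~p | _ = ⊥-elim (p≁q (Conn-sym q~p))

  InFwd⇒Crossing : ∀ {P u r τ F} → SpanningTree G τ × InFwd G P u r τ F → Crossing F u r P τ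
  InFwd⇒Crossing (_ , i , j , e , dir , path , e∈τ , eij , refl) with treePath-sides path eij
  ... | u~i , j~r = e , i , j , dir , eij , Conn-sym u~i , j~r , sym (─-＋-cancel e∈τ)

  InRev⇒Crossing : ∀ {P u r τ F} → SpanningTree G τ × InRev G P u r τ F → Crossing F r u P τ
  InRev⇒Crossing (_ , i , j , e , dir , path , e∈τ , eij , refl) with treePath-sides path (Joins-sym eij)
  ... | u~j , i~r = e , i , j , dir , eij , i~r , Conn-sym u~j , sym (─-＋-cancel e∈τ)

  InFwd⇒separated : ∀ {P u r τ F} → SpanningTree G τ × InFwd G P u r τ F → ¬ Conn G F u r
  InFwd⇒separated ((_ , acyclic) , i , j , e , _ , path , e∈τ , eij , refl) u~r with treePath-sides path eij
  ... | u~i , j~r = Acyclic⇒bridge acyclic e∈τ eij (Conn-sym u~i ◅◅ u~r ◅◅ Conn-sym j~r)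

  InRev⇒separated : ∀ {P u r τ F} → SpanningTree G τ × InRev G P u r τ F → ¬ Conn G F u r
  InRev⇒separated ((_ , acyclic) , i , j , e , _ , path , e∈τ , eij , refl) u~r with treePath-sides path (Joins-sym eij)
  ... | u~j , i~r = Acyclic⇒bridge acyclic e∈τ eij (i~r ◅◅ Conn-sym u~r ◅◅ u~j)

  Crossing⇒InFwd : ∀ {P u r τ F} → Sides F u r → Acyclic G F → ¬ Conn G F u r →
                   Crossing F u r P τ → SpanningTree G τ × InFwd G P u r τ F
  Crossing⇒InFwd {F = F} side acyclic u≁r (e , a , b , dir , eab , a~u , b~r , refl) =
    (Connected-＋ side a~u b~r eab , Acyclic-＋ acyclic eab a≁b) ,
    a , b , e , dir , treePath-＋ a~u b~r eab u≁r , []≔-updates F e , eab ,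
    sym (＋-─-cancel (Joins⇒∉ a≁b eab))
    where
    a≁b : ¬ Conn G F a b
    a≁b a~b = u≁r (Conn-sym a~u ◅◅ a~b ◅◅ b~r)

  Crossing⇒InRev : ∀ {P u r τ F} → Sides F u r → Acyclic G F → ¬ Conn G F u r →
                   Crossing F r u P τ → SpanningTree G τ × InRev G P u r τ F
  Crossing⇒InRev {F = F} side acyclic u≁r (e , a , b , dir , eab , a~r , b~u , refl) =
    (Connected-＋ side b~u a~r (Joins-sym eab) , Acyclic-＋ acyclic eab a≁b) ,
    a , b , e , dir , treePath-＋ b~u a~r (Joins-sym eab) u≁r , []≔-updates F e , eab ,
    sym (＋-─-cancel (Joins⇒∉ a≁b eab))
    where
    a≁b : ¬ Conn G F a b
    a≁b a~b = u≁r (Conn-sym b~u ◅◅ Conn-sym a~b ◅◅ a~r)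

+[1+n]-+n≡1 : ∀ n → + suc n - + n ≡ + 1
+[1+n]-+n≡1 n = begin
  + suc n - + n   ≡⟨ m-n≡m⊖n (suc n) n ⟩
  suc n ⊖ n       ≡⟨ ⊖-≥ (n≤1+n n) ⟩
  + (suc n ∸ n)   ≡⟨ cong +_ (m+n∸n≡m 1 n) ⟩
  + 1             ∎
  where open ≡-Reasoning

mainTheorem2 : {n m : ℕ} (G : Graph n m) → Simple G → Connected G ⊤ →
               (r u : Fin n) → r ≢ u →
               (P : List (Fin n)) → PathFromTo G ⊤ u r P →
               (F : Subset m) → TwoForest G F →
               (Lf Lr : List (Subset m)) →
               Enumerates (λ τ → SpanningTree G τ × InFwd G P u r τ F) Lf →
               Enumerates (λ τ → SpanningTree G τ × InRev G P u r τ F) Lr →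
               (InFru G r u F → (+ length Lf) - (+ length Lr) ≡ + 1) ×
               (¬ InFru G r u F → (+ length Lf) - (+ length Lr) ≡ + 0)
mainTheorem2 G simple _ r u _ P ((P-unique , P-linked) , P-head , P-last) F twoForest Lf Lr enumFwd enumRev =
    (λ (_ , r≁u) → trans (cong (λ k → + k - + length Lr) (length-Lf≡1+length-Lr r≁u)) (+[1+n]-+n≡1 (length Lr)))
  , (λ ¬inFru → cong₂ (λ k l → + k - + l)
       (Enumerates-empty enumFwd λ _ fwd → ¬inFru (twoForest , InFwd⇒separated fwd ∘ Conn-sym))
       (Enumerates-empty enumRev λ _ rev → ¬inFru (twoForest , InRev⇒separated rev ∘ Conn-sym)))
  where
  open Walks G
  open Forests G simple
  open ≡-Reasoning

  length-Lf≡1+length-Lr : ¬ Conn G F r u → length Lf ≡ suc (length Lr)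
  length-Lf≡1+length-Lr r≁u = begin
    length Lf                                          ≡⟨ Lf-enumerates-crossings ⟩
    length (crossings side P P-linked)                 ≡⟨ crossings-path-count side u≁r P-linked P-head P-last ⟩
    suc (length (crossings (swap ∘ side) P P-linked))  ≡⟨ cong suc Lr-enumerates-crossings ⟨
    suc (length Lr)                                    ∎
    where
    u≁r : ¬ Conn G F u r
    u≁r = r≁u ∘ Conn-sym
    side : Sides F u r
    side = twoForest-sides twoForest u≁r
    acyclic : Acyclic G F
    acyclic = proj₁ twoForest
    Lf-enumerates-crossings : length Lf ≡ length (crossings side P P-linked)
    Lf-enumerates-crossings = Enumerates-length enumFwd
      (crossings-unique side u≁r P-linked P-unique)
      (∈-crossings⁺ side u≁r P-linked ∘ InFwd⇒Crossing)
      (Crossing⇒InFwd side acyclic u≁r ∘ ∈-crossings⁻ side P-linked)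
    Lr-enumerates-crossings : length Lr ≡ length (crossings (swap ∘ side) P P-linked)
    Lr-enumerates-crossings = Enumerates-length enumRev
      (crossings-unique (swap ∘ side) r≁u P-linked P-unique)
      (∈-crossings⁺ (swap ∘ side) r≁u P-linked ∘ InRev⇒Crossing)
      (Crossing⇒InRev side acyclic u≁r ∘ ∈-crossings⁻ (swap ∘ side) P-linked)
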